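{- For all natural numbers $k,m$ we have $D\big(k,k^m,(k+1)^m\big)\leq m\log_2(k+1)$.
   Context: For a natural number $n$, $[n]=\{1,\dots,n\}$, and for a set $A$ and $s\in\mathbb{N}$, $\binom{A}{s}$ denotes the set of $s$-element subsets of $A$. A set $A$ is shattered by a family $\mathcal{F}$ of sets if $\{A\cap S: S\in\mathcal{F}\}=2^A$. The VC-dimension of $\mathcal{F}$ is the size of the largest finite set shattered by $\mathcal{F}$. A family $\mathcal{F}\subseteq 2^X$ has the $k$-covering property if every $k$-element subset of $X$ is contained in some member of $\mathcal{F}$. For natural numbers $k\leq s\leq n$, $D(k,s,n)$ denotes the smallest VC-dimension of a family $\mathcal{F}\subseteq\binom{[n]}{s}$ having the $k$-covering property (as subsets of $[n]$). -}

module Defs where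

open import Data.Nat using (ℕ; _≤_)
open import Data.Fin.Subset using (Subset; _⊆_; _∩_; ∣_∣)
open import Data.List using (List)
open import Data.List.Membership.Propositional using (_∈_)
open import Data.Product using (Σ; _×_; ∃-syntax)
open import Relation.Binary.PropositionalEquality using (_≡_)

-- Ground set [n] is modelled as Fin n; subsets of [n] as Subset n.
-- A (finite) family of subsets of [n] is a list of subsets (duplicates harmless).
Family : ℕ → Set
Family n = List (Subset n)

-- A is shattered by F : {A ∩ S : S ∈ F} = 2^A, i.e. every B ⊆ A equals A ∩ S for some S ∈ F
-- (the inclusion {A ∩ S} ⊆ 2^A is automatic).
Shatters : ∀ {n} → Family n → Subset n → Set
Shatters F A = ∀ B → B ⊆ A → ∃[ S ] (S ∈ F × A ∩ S ≡ B)

VCDimAtMost : ∀ {n} → Family n → ℕ → Set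
VCDimAtMost F d = ∀ A → Shatters F A → ∣ A ∣ ≤ d

Uniform : ∀ {n} → ℕ → Family n → Set
Uniform s F = ∀ S → S ∈ F → ∣ S ∣ ≡ s

KCovering : ∀ {n} → ℕ → Family n → Set
KCovering k F = ∀ K → ∣ K ∣ ≡ k → ∃[ S ] (S ∈ F × K ⊆ S)

DAtMost : ℕ → ℕ → ℕ → ℕ → Set
DAtMost k s n d = ∃[ F ] (Uniform {n} s F × KCovering k F × VCDimAtMost F d)

{-# OPTIONS --safe #-}

-- View [(k+1)^m] as the grid [k+1]^m and take all boxes S₁ × ⋯ × Sₘ whose sides
-- are complements of singletons: there are (k+1)^m of them, each of size k^m.
-- A set K of at most k points has every coordinate projection of size at most k,
-- so each projection misses some point and K lies in the box of those
-- complements. A family shattering A has at least 2^∣A∣ members, hence the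
-- VC-dimension is at most ⌊log₂ (k+1)^m⌋.
module Submission where

open import Defs
open import Data.Nat using (ℕ; suc; _^_; _≤_)
open import Data.Product using (Σ; _×_; ∃-syntax)

open import Data.Nat using (zero; _+_; _*_; _∸_; _<_; NonZero; z≤n; s≤s; s≤s⁻¹; _<?_)
open import Data.Nat.Properties
open import Data.Product using (_,_; ∃₂)
open import Data.Fin using (zero; suc)
open import Data.Vec using ([]; _∷_; _++_; tail; splitAt; here; there)
open import Data.Vec.Properties using (∷-injective)
open import Data.Fin.Subset
  using (Subset; Side; inside; outside; ⊥; ⊤; ⁅_⁆; ∁; _∪_; _⊆_; _∉_; ∣_∣; Nonempty)
open import Data.Fin.Subset.Properties
  using (⊆-refl; ⊆-trans; drop-∷-⊆; drop-there; out⊆; ⊥⊆; ⊆⊤; p⊆p∪q; q⊆p∪q; p⊆q⇒∣p∣≤∣q∣;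
         ∣⊥∣≡0; ∣⁅x⁆∣≡1; ∣∁p∣≡n∸∣p∣; x∈⁅y⁆⇒x≡y; x∉p⇒x∈∁p; nonempty?)
open import Data.List using (length; map; allFin; cartesianProductWith)
  renaming (_∷_ to _∷ₗ_; [] to []ₗ; _++_ to _++ₗ_)
open import Data.List.Properties using (length-map; length-++; length-tabulate)
open import Data.List.Membership.Propositional using (_∈_)
open import Data.List.Membership.Propositional.Properties
  using (∈-map⁺; ∈-map⁻; ∈-allFin; ∈-length; ∈-cartesianProductWith⁺; ∈-cartesianProductWith⁻)
open import Data.List.Relation.Unary.Any as Any using ()
open import Relation.Binary.PropositionalEquality
open import Relation.Nullary using (yes; no; contradiction)

private
  variable
    a b n : ℕ

∣p++q∣≡∣p∣+∣q∣ : (p : Subset a) (q : Subset b) → ∣ p ++ q ∣ ≡ ∣ p ∣ + ∣ q ∣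
∣p++q∣≡∣p∣+∣q∣ []            q = refl
∣p++q∣≡∣p∣+∣q∣ (inside ∷ p)  q = cong suc (∣p++q∣≡∣p∣+∣q∣ p q)
∣p++q∣≡∣p∣+∣q∣ (outside ∷ p) q = ∣p++q∣≡∣p∣+∣q∣ p q

∣p∪q∣≤∣p∣+∣q∣ : (p q : Subset n) → ∣ p ∪ q ∣ ≤ ∣ p ∣ + ∣ q ∣
∣p∪q∣≤∣p∣+∣q∣ []            []            = z≤n
∣p∪q∣≤∣p∣+∣q∣ (inside ∷ p)  (outside ∷ q) = s≤s (∣p∪q∣≤∣p∣+∣q∣ p q)
∣p∪q∣≤∣p∣+∣q∣ (inside ∷ p)  (inside ∷ q)  =
  s≤s (≤-trans (∣p∪q∣≤∣p∣+∣q∣ p q) (+-monoʳ-≤ ∣ p ∣ (n≤1+n ∣ q ∣)))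
∣p∪q∣≤∣p∣+∣q∣ (outside ∷ p) (inside ∷ q)  =
  ≤-trans (s≤s (∣p∪q∣≤∣p∣+∣q∣ p q)) (≤-reflexive (sym (+-suc ∣ p ∣ ∣ q ∣)))
∣p∪q∣≤∣p∣+∣q∣ (outside ∷ p) (outside ∷ q) = ∣p∪q∣≤∣p∣+∣q∣ p q

nonempty⇒∣p∣>0 : (p : Subset n) → Nonempty p → 0 < ∣ p ∣
nonempty⇒∣p∣>0 (inside ∷ p)  _                    = s≤s z≤n
nonempty⇒∣p∣>0 (outside ∷ p) (suc x , there x∈p) = nonempty⇒∣p∣>0 p (x , x∈p)

∣p∣<n⇒∃∉ : (p : Subset n) → ∣ p ∣ < n → ∃[ i ] i ∉ p
∣p∣<n⇒∃∉ (outside ∷ p) _ = zero , λ ()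
∣p∣<n⇒∃∉ (inside ∷ p) (s≤s ∣p∣<n) =
  let i , i∉p = ∣p∣<n⇒∃∉ p ∣p∣<n in suc i , λ i∈ → i∉p (drop-there i∈)

++-mono-⊆ : {p q : Subset a} {p′ q′ : Subset b} → p ⊆ q → p′ ⊆ q′ → p ++ p′ ⊆ q ++ q′
++-mono-⊆ {p = []}    {q = []}    _   p′⊆q′ x∈p′       = p′⊆q′ x∈p′
++-mono-⊆ {p = _ ∷ _} {q = _ ∷ _} p⊆q _     here        with p⊆q here
... | here = here
++-mono-⊆ {p = _ ∷ _} {q = _ ∷ _} p⊆q p′⊆q′ (there x∈) = there (++-mono-⊆ (drop-∷-⊆ p⊆q) p′⊆q′ x∈)

-- Fin (a * b) is read as a rows of length b, so S ⊗ T is the product S × T in row-major order.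
infixr 7 _⊗_

_⊗_ : Subset a → Subset b → Subset (a * b)
[]            ⊗ T = []
(inside ∷ S)  ⊗ T = T ++ S ⊗ T
(outside ∷ S) ⊗ T = ⊥ ++ S ⊗ T

∣S⊗T∣≡∣S∣*∣T∣ : (S : Subset a) (T : Subset b) → ∣ S ⊗ T ∣ ≡ ∣ S ∣ * ∣ T ∣
∣S⊗T∣≡∣S∣*∣T∣ []            T = refl
∣S⊗T∣≡∣S∣*∣T∣ (inside ∷ S)  T = begin
  ∣ T ++ S ⊗ T ∣          ≡⟨ ∣p++q∣≡∣p∣+∣q∣ T (S ⊗ T) ⟩
  ∣ T ∣ + ∣ S ⊗ T ∣       ≡⟨ cong (∣ T ∣ +_) (∣S⊗T∣≡∣S∣*∣T∣ S T) ⟩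
  ∣ T ∣ + ∣ S ∣ * ∣ T ∣   ∎
  where open ≡-Reasoning
∣S⊗T∣≡∣S∣*∣T∣ {b = b} (outside ∷ S) T = begin
  ∣ ⊥ {b} ++ S ⊗ T ∣      ≡⟨ ∣p++q∣≡∣p∣+∣q∣ (⊥ {b}) (S ⊗ T) ⟩
  ∣ ⊥ {b} ∣ + ∣ S ⊗ T ∣   ≡⟨ cong₂ _+_ (∣⊥∣≡0 b) (∣S⊗T∣≡∣S∣*∣T∣ S T) ⟩
  ∣ S ∣ * ∣ T ∣           ∎
  where open ≡-Reasoning

⊗-mono-⊆ : {S S′ : Subset a} {T T′ : Subset b} → S ⊆ S′ → T ⊆ T′ → S ⊗ T ⊆ S′ ⊗ T′
⊗-mono-⊆ {S = []}          {S′ = []}           _   _    = λ ()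
⊗-mono-⊆ {S = inside ∷ _}  {S′ = inside ∷ _}  S⊆S′ T⊆T′ = ++-mono-⊆ T⊆T′ (⊗-mono-⊆ (drop-∷-⊆ S⊆S′) T⊆T′)
⊗-mono-⊆ {S = inside ∷ _}  {S′ = outside ∷ _} S⊆S′ _    = contradiction (S⊆S′ here) λ ()
⊗-mono-⊆ {S = outside ∷ _} {S′ = inside ∷ _}  S⊆S′ T⊆T′ = ++-mono-⊆ ⊥⊆ (⊗-mono-⊆ (drop-∷-⊆ S⊆S′) T⊆T′)
⊗-mono-⊆ {S = outside ∷ _} {S′ = outside ∷ _} S⊆S′ T⊆T′ = ++-mono-⊆ ⊆-refl (⊗-mono-⊆ (drop-∷-⊆ S⊆S′) T⊆T′)

-- R marks the nonempty rows of K and C is the union of its rows.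
⊆-⊗-of-projections : ∀ a {b} (K : Subset (a * b)) →
  ∃₂ λ (R : Subset a) (C : Subset b) → ∣ R ∣ ≤ ∣ K ∣ × ∣ C ∣ ≤ ∣ K ∣ × K ⊆ R ⊗ C
⊆-⊗-of-projections zero    {b} [] = [] , ⊥ , z≤n , ≤-reflexive (∣⊥∣≡0 b) , λ ()
⊆-⊗-of-projections (suc a) {b} K with splitAt b K
... | r , K′ , refl with ⊆-⊗-of-projections a K′ | nonempty? r
...   | R , C , ∣R∣≤∣K′∣ , ∣C∣≤∣K′∣ , K′⊆R⊗C | no r-empty =
  outside ∷ R , C ,
  ≤-trans ∣R∣≤∣K′∣ ∣K′∣≤∣r++K′∣ ,
  ≤-trans ∣C∣≤∣K′∣ ∣K′∣≤∣r++K′∣ ,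
  ++-mono-⊆ (λ x∈r → contradiction (_ , x∈r) r-empty) K′⊆R⊗C
  where
  ∣K′∣≤∣r++K′∣ : ∣ K′ ∣ ≤ ∣ r ++ K′ ∣
  ∣K′∣≤∣r++K′∣ = ≤-trans (m≤n+m ∣ K′ ∣ ∣ r ∣) (≤-reflexive (sym (∣p++q∣≡∣p∣+∣q∣ r K′)))
...   | R , C , ∣R∣≤∣K′∣ , ∣C∣≤∣K′∣ , K′⊆R⊗C | yes r-nonempty =
  inside ∷ R , r ∪ C ,
  ≤-trans (+-mono-≤ (nonempty⇒∣p∣>0 r r-nonempty) ∣R∣≤∣K′∣) ∣r∣+∣K′∣≤∣r++K′∣ ,
  ≤-trans (∣p∪q∣≤∣p∣+∣q∣ r C) (≤-trans (+-monoʳ-≤ ∣ r ∣ ∣C∣≤∣K′∣) ∣r∣+∣K′∣≤∣r++K′∣) ,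
  ++-mono-⊆ (p⊆p∪q C) (⊆-trans K′⊆R⊗C (⊗-mono-⊆ {S = R} ⊆-refl (q⊆p∪q r C)))
  where
  ∣r∣+∣K′∣≤∣r++K′∣ : ∣ r ∣ + ∣ K′ ∣ ≤ ∣ r ++ K′ ∣
  ∣r∣+∣K′∣≤∣r++K′∣ = ≤-reflexive (sym (∣p++q∣≡∣p∣+∣q∣ r K′))

CoversUpTo : ℕ → Family n → Set
CoversUpTo k F = ∀ K → ∣ K ∣ ≤ k → ∃[ S ] (S ∈ F × K ⊆ S)

CoversUpTo⇒KCovering : ∀ {k} {F : Family n} → CoversUpTo k F → KCovering k F
CoversUpTo⇒KCovering covers K ∣K∣≡k = covers K (≤-reflexive ∣K∣≡k)

infixr 7 _⊗ᶠ_

_⊗ᶠ_ : Family a → Family b → Family (a * b)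
_⊗ᶠ_ = cartesianProductWith _⊗_

length-⊗ᶠ : (G : Family a) (H : Family b) → length (G ⊗ᶠ H) ≡ length G * length H
length-⊗ᶠ []ₗ       H = refl
length-⊗ᶠ (S ∷ₗ G) H = begin
  length (map (S ⊗_) H ++ₗ G ⊗ᶠ H)       ≡⟨ length-++ (map (S ⊗_) H) ⟩
  length (map (S ⊗_) H) + length (G ⊗ᶠ H) ≡⟨ cong₂ _+_ (length-map (S ⊗_) H) (length-⊗ᶠ G H) ⟩
  length H + length G * length H          ∎
  where open ≡-Reasoning

Uniform-⊗ᶠ : ∀ {s t} {G : Family a} {H : Family b} →
  Uniform s G → Uniform t H → Uniform (s * t) (G ⊗ᶠ H)
Uniform-⊗ᶠ {G = G} {H} uniformG uniformH U U∈G⊗H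
  with S , T , S∈G , T∈H , refl ← ∈-cartesianProductWith⁻ _⊗_ G H U∈G⊗H =
  trans (∣S⊗T∣≡∣S∣*∣T∣ S T) (cong₂ _*_ (uniformG S S∈G) (uniformH T T∈H))

CoversUpTo-⊗ᶠ : ∀ {k} {G : Family a} {H : Family b} →
  CoversUpTo k G → CoversUpTo k H → CoversUpTo k (G ⊗ᶠ H)
CoversUpTo-⊗ᶠ {a = a} coversG coversH K ∣K∣≤k
  with R , C , ∣R∣≤∣K∣ , ∣C∣≤∣K∣ , K⊆R⊗C ← ⊆-⊗-of-projections a K
  with S , S∈G , R⊆S ← coversG R (≤-trans ∣R∣≤∣K∣ ∣K∣≤k)
  with T , T∈H , C⊆T ← coversH C (≤-trans ∣C∣≤∣K∣ ∣K∣≤k) =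
  S ⊗ T , ∈-cartesianProductWith⁺ _⊗_ S∈G T∈H , ⊆-trans K⊆R⊗C (⊗-mono-⊆ R⊆S C⊆T)

infixr 8 _^⊗_

_^⊗_ : Family n → (m : ℕ) → Family (n ^ m)
F ^⊗ zero  = ⊤ ∷ₗ []ₗ
F ^⊗ suc m = F ⊗ᶠ F ^⊗ m

length-^⊗ : (F : Family n) (m : ℕ) → length (F ^⊗ m) ≡ length F ^ m
length-^⊗ F zero    = refl
length-^⊗ F (suc m) = trans (length-⊗ᶠ F (F ^⊗ m)) (cong (length F *_) (length-^⊗ F m))

Uniform-^⊗ : ∀ {s} {F : Family n} (m : ℕ) → Uniform s F → Uniform (s ^ m) (F ^⊗ m)
Uniform-^⊗ zero    uniform _ (Any.here refl) = refl
Uniform-^⊗ (suc m) uniform = Uniform-⊗ᶠ uniform (Uniform-^⊗ m uniform)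

CoversUpTo-^⊗ : ∀ {k} {F : Family n} (m : ℕ) → CoversUpTo k F → CoversUpTo k (F ^⊗ m)
CoversUpTo-^⊗ zero    covers _ _ = ⊤ , Any.here refl , ⊆⊤
CoversUpTo-^⊗ (suc m) covers = CoversUpTo-⊗ᶠ covers (CoversUpTo-^⊗ m covers)

coSingletons : ∀ n → Family n
coSingletons n = map (λ i → ∁ ⁅ i ⁆) (allFin n)

length-coSingletons : ∀ n → length (coSingletons n) ≡ n
length-coSingletons n = trans (length-map _ (allFin n)) (length-tabulate _)

Uniform-coSingletons : ∀ n → Uniform (n ∸ 1) (coSingletons n)
Uniform-coSingletons n S S∈coSingletons with i , _ , refl ← ∈-map⁻ _ S∈coSingletons =
  trans (∣∁p∣≡n∸∣p∣ ⁅ i ⁆) (cong (n ∸_) (∣⁅x⁆∣≡1 i))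

CoversUpTo-coSingletons : ∀ k → CoversUpTo k (coSingletons (suc k))
CoversUpTo-coSingletons k K ∣K∣≤k with i , i∉K ← ∣p∣<n⇒∃∉ K (s≤s ∣K∣≤k) =
  ∁ ⁅ i ⁆ , ∈-map⁺ _ (∈-allFin i) ,
  λ x∈K → x∉p⇒x∈∁p (λ x∈⁅i⁆ → i∉K (subst _ (x∈⁅y⁆⇒x≡y i x∈⁅i⁆) x∈K))

slice : Side → Family (suc n) → Family n
slice _       []ₗ                  = []ₗ
slice outside ((outside ∷ S) ∷ₗ F) = S ∷ₗ slice outside F
slice outside ((inside ∷ _)  ∷ₗ F) = slice outside F
slice inside  ((outside ∷ _) ∷ₗ F) = slice inside F
slice inside  ((inside ∷ S)  ∷ₗ F) = S ∷ₗ slice inside F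

length-slices : (F : Family (suc n)) → length (slice outside F) + length (slice inside F) ≡ length F
length-slices []ₗ                  = refl
length-slices ((outside ∷ _) ∷ₗ F) = cong suc (length-slices F)
length-slices ((inside ∷ _)  ∷ₗ F) =
  trans (+-suc (length (slice outside F)) (length (slice inside F))) (cong suc (length-slices F))

∈-slice : ∀ x {S : Subset n} (F : Family (suc n)) → (x ∷ S) ∈ F → S ∈ slice x F
∈-slice outside ((outside ∷ _) ∷ₗ F) (Any.here refl) = Any.here refl
∈-slice inside  ((inside ∷ _)  ∷ₗ F) (Any.here refl) = Any.here refl
∈-slice outside ((outside ∷ _) ∷ₗ F) (Any.there S∈F) = Any.there (∈-slice outside F S∈F)
∈-slice outside ((inside ∷ _)  ∷ₗ F) (Any.there S∈F) = ∈-slice outside F S∈F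
∈-slice inside  ((outside ∷ _) ∷ₗ F) (Any.there S∈F) = ∈-slice inside F S∈F
∈-slice inside  ((inside ∷ _)  ∷ₗ F) (Any.there S∈F) = Any.there (∈-slice inside F S∈F)

Shatters-slice : ∀ x {F : Family (suc n)} {A} → Shatters F (inside ∷ A) → Shatters (slice x F) A
Shatters-slice x {F} shatters B B⊆A
  with (y ∷ S) , yS∈F , A∩yS≡xB ← shatters (x ∷ B) (λ { here → here ; (there z∈B) → there (B⊆A z∈B) })
  with refl , A∩S≡B ← ∷-injective A∩yS≡xB =
  S , ∈-slice x F yS∈F , A∩S≡B

Shatters-tail : ∀ {F : Family (suc n)} {A} → Shatters F (outside ∷ A) → Shatters (map tail F) A
Shatters-tail shatters B B⊆A with (_ ∷ S) , yS∈F , A∩yS≡B ← shatters (outside ∷ B) (out⊆ B⊆A) =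
  S , ∈-map⁺ tail yS∈F , cong tail A∩yS≡B

Shatters⇒2^∣A∣≤length : (F : Family n) (A : Subset n) → Shatters F A → 2 ^ ∣ A ∣ ≤ length F
Shatters⇒2^∣A∣≤length F [] shatters with _ , S∈F , _ ← shatters [] (λ ()) = ∈-length S∈F
Shatters⇒2^∣A∣≤length F (outside ∷ A) shatters = begin
  2 ^ ∣ A ∣           ≤⟨ Shatters⇒2^∣A∣≤length (map tail F) A (Shatters-tail shatters) ⟩
  length (map tail F) ≡⟨ length-map tail F ⟩
  length F            ∎
  where open ≤-Reasoning
Shatters⇒2^∣A∣≤length F (inside ∷ A) shatters = begin
  2 ^ ∣ A ∣ + (2 ^ ∣ A ∣ + 0)                            ≡⟨ cong (2 ^ ∣ A ∣ +_) (+-identityʳ _) ⟩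
  2 ^ ∣ A ∣ + 2 ^ ∣ A ∣                                  ≤⟨ +-mono-≤ (half outside) (half inside) ⟩
  length (slice outside F) + length (slice inside F)     ≡⟨ length-slices F ⟩
  length F                                               ∎
  where
  open ≤-Reasoning
  half : ∀ x → 2 ^ ∣ A ∣ ≤ length (slice x F)
  half x = Shatters⇒2^∣A∣≤length (slice x F) A (Shatters-slice x shatters)

^-cancelʳ-< : ∀ m .{{_ : NonZero m}} {a b} → m ^ a < m ^ b → a < b
^-cancelʳ-< m {a} {b} m^a<m^b with a <? b
... | yes a<b = a<b
... | no  a≮b = contradiction (^-monoʳ-≤ m (≮⇒≥ a≮b)) (<⇒≱ m^a<m^b)

length<2^[1+d]⇒VCDimAtMost : ∀ {d} (F : Family n) → length F < 2 ^ suc d → VCDimAtMost F d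
length<2^[1+d]⇒VCDimAtMost F ∣F∣<2^[1+d] A shatters =
  s≤s⁻¹ (^-cancelʳ-< 2 (≤-<-trans (Shatters⇒2^∣A∣≤length F A shatters) ∣F∣<2^[1+d]))

⌊log₂⌋-exists : ∀ N → 0 < N → ∃[ d ] (2 ^ d ≤ N × N < 2 ^ suc d)
⌊log₂⌋-exists (suc zero)    _ = 0 , ≤-refl , s≤s (s≤s z≤n)
⌊log₂⌋-exists (suc (suc n)) _ with d , 2^d≤1+n , 1+n<2^[1+d] ← ⌊log₂⌋-exists (suc n) (s≤s z≤n)
  with suc (suc n) <? 2 ^ suc d
... | yes 2+n<2^[1+d] = d , m≤n⇒m≤1+n 2^d≤1+n , 2+n<2^[1+d]
... | no  2+n≮2^[1+d] =
  suc d , ≮⇒≥ 2+n≮2^[1+d] , ≤-<-trans 1+n<2^[1+d] (^-monoʳ-< 2 (s≤s (s≤s z≤n)) (n<1+n (suc d)))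

mainTheorem6 : ∀ (k m : ℕ) →
    ∃[ d ] (2 ^ d ≤ suc k ^ m × DAtMost k (k ^ m) (suc k ^ m) d)
mainTheorem6 k m with d , 2^d≤N , N<2^[1+d] ← ⌊log₂⌋-exists (suc k ^ m) (m^n>0 (suc k) m) =
  d , 2^d≤N , F ,
  Uniform-^⊗ m (Uniform-coSingletons (suc k)) ,
  CoversUpTo⇒KCovering (CoversUpTo-^⊗ m (CoversUpTo-coSingletons k)) ,
  length<2^[1+d]⇒VCDimAtMost F (subst (_< 2 ^ suc d) (sym length-F) N<2^[1+d])
  where
  F : Family (suc k ^ m)
  F = coSingletons (suc k) ^⊗ m
  length-F : length F ≡ suc k ^ m
  length-F = trans (length-^⊗ (coSingletons (suc k)) m) (cong (_^ m) (length-coSingletons (suc k)))
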